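{- The spectrum of a partial plane spread of size $17$ in $\mathrm{PG}(6,2)$ is $(1^7\,2^{112}\,3^8)$, i.e. $a_1=7$, $a_2=112$, $a_3=8$ and $a_i=0$ for all other $i$.
   Context: A partial plane spread is a set of $3$-dimensional subspaces (blocks) of $\mathbb{F}_2^7$ pairwise intersecting in $\{0\}$. Its spectrum is $(a_i)_{i\ge0}$ with $a_i$ the number of hyperplanes ($6$-dimensional subspaces) containing exactly $i$ blocks, written in exponential notation $(i^{a_i}\dots)$. -}

module Defs where

open import Data.Bool using (Bool; true; false; _xor_; not; _∨_; _∧_)
open import Data.Nat using (ℕ; zero; suc; _^_)
open import Data.Fin using (Fin)
open import Data.Vec using (Vec; []; _∷_; zipWith; replicate)
open import Data.List using (List; []; _∷_; map; _++_; length; filterᵇ)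
open import Data.List.Relation.Unary.All using (All)
open import Data.List.Relation.Unary.Any using (Any)
open import Data.List.Relation.Unary.AllPairs using (AllPairs)
open import Data.Product using (Σ; _×_)
open import Relation.Nullary using (¬_)
open import Relation.Binary.PropositionalEquality using (_≡_; _≢_; _≗_)

-- Vectors of 𝔽₂ⁿ, with 𝔽₂ = Bool (false = 0, true = 1, addition = xor).
𝔽₂^ : ℕ → Set
𝔽₂^ n = Vec Bool n

V : Set
V = 𝔽₂^ 7

_⊕_ : V → V → V
_⊕_ = zipWith _xor_

𝟎 : V
𝟎 = replicate 7 false

allVecs : (n : ℕ) → List (𝔽₂^ n)
allVecs zero = [] ∷ []
allVecs (suc n) = map (false ∷_) (allVecs n) ++ map (true ∷_) (allVecs n)

SubsetV : Set
SubsetV = V → Bool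

card : SubsetV → ℕ
card S = length (filterᵇ S (allVecs 7))

-- Linear subspace of 𝔽₂⁷ (over 𝔽₂, closure under addition suffices for scalars).
IsSubspace : SubsetV → Set
IsSubspace S = (S 𝟎 ≡ true) × (∀ x y → S x ≡ true → S y ≡ true → S (x ⊕ y) ≡ true)

IsSubspaceOfDim : ℕ → SubsetV → Set
IsSubspaceOfDim k S = IsSubspace S × (card S ≡ 2 ^ k)

IsPlane : SubsetV → Set
IsPlane = IsSubspaceOfDim 3

IsHyperplane : SubsetV → Set
IsHyperplane = IsSubspaceOfDim 6

IsPartialPlaneSpread : (m : ℕ) → (Fin m → SubsetV) → Set
IsPartialPlaneSpread m B =
  (∀ i → IsPlane (B i)) ×
  (∀ i j → i ≢ j → ∀ x → B i x ≡ true → B j x ≡ true → x ≡ 𝟎)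

allᵇ : {A : Set} → (A → Bool) → List A → Bool
allᵇ p [] = true
allᵇ p (x ∷ xs) = p x ∧ allᵇ p xs

_⊆ᵇ_ : SubsetV → SubsetV → Bool
S ⊆ᵇ T = allᵇ (λ x → not (S x) ∨ T x) (allVecs 7)

allFins : (m : ℕ) → List (Fin m)
allFins zero = []
allFins (suc m) = Fin.zero ∷ map Fin.suc (allFins m)

blocksIn : (m : ℕ) → (Fin m → SubsetV) → SubsetV → ℕ
blocksIn m B H = length (filterᵇ (λ j → B j ⊆ᵇ H) (allFins m))

-- "The collection of subsets S of 𝔽₂⁷ satisfying P has exactly n elements"
-- (subsets identified up to extensional equality ≗): there is a duplicate-free
-- list of length n of subsets satisfying P containing every such subset.
HasCount : (SubsetV → Set) → ℕ → Set
HasCount P n =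
  Σ (List SubsetV) λ L →
    (length L ≡ n) × All P L × AllPairs (λ S T → ¬ (S ≗ T)) L ×
    (∀ S → P S → Any (λ T → S ≗ T) L)

HasSpectrumValue : (m : ℕ) → (Fin m → SubsetV) → ℕ → ℕ → Set
HasSpectrumValue m B i a = HasCount (λ H → IsHyperplane H × (blocksIn m B H ≡ i)) a

expectedSpectrum : ℕ → ℕ
expectedSpectrum 1 = 7
expectedSpectrum 2 = 112
expectedSpectrum 3 = 8
expectedSpectrum _ = 0

{-# OPTIONS --safe #-}
-- The hyperplanes of 𝔽₂⁷ are the kernels of the 127 nonzero functionals x ↦ a · x. A plane meets a
-- hyperplane H in 4 points, or in all 8 when it lies in H. The 17 disjoint planes cover 119 of the 127
-- nonzero vectors, leaving a set X of 8 uncovered ones. Counting the 63 nonzero vectors of H through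
-- the planes gives 3·17 + 4 i_H + |X ∩ H| = 63, where i_H is the number of planes inside H; as
-- |X ∩ H| ≤ 8, this forces (i_H, |X ∩ H|) ∈ {(1,8), (2,4), (3,0)}. Since every nonzero vector lies in
-- 63 hyperplanes and every pair in 31, Σ_H |X ∩ H| = 63·8 and Σ_H |X ∩ H|² = 31·8² + 32·8. Together
-- with a₁ + a₂ + a₃ = 127 these linear equations give a₁ = 7, a₂ = 112, a₃ = 8.
module Submission where

open import Defs
open import Algebra.Bundles using (CommutativeRing)
open import Data.Bool using (Bool; true; false; _xor_; not; _∧_; _∨_)
open import Data.Bool.Properties
  using (xor-comm; xor-assoc; xor-identityˡ; xor-identityʳ; xor-same; ∧-comm; ∧-zeroʳ; ∧-identityʳ;
         ∧-distribˡ-xor; not-injective; not-involutive; ¬-not; xor-∧-commutativeRing)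
  renaming (_≟_ to _≟ᵇ_)
open import Data.Nat using (ℕ; zero; suc; _+_; _*_; _∸_; _≤_; z≤n; s≤s; _≤?_; _≟_; ⌊_/2⌋)
open import Data.Nat.Properties
  using (suc-injective; <⇒≱; ≤-reflexive; ≤-trans; +-mono-≤; +-comm; +-assoc; +-identityʳ; *-comm; *-assoc;
         *-identityʳ; *-zeroʳ; *-suc; *-distribˡ-+; +-cancelˡ-≡; +-cancelʳ-≡; *-cancelˡ-≡; n≡⌊n+n/2⌋;
         +-commutativeSemigroup)
open import Data.Nat.Tactic.RingSolver using (solve-∀)
open import Data.Fin using (Fin)
import Data.Fin.Properties as Finₚ
open import Data.Vec using ([]; _∷_; zipWith; replicate; tabulate; lookup)
open import Data.Vec.Properties
  using (zipWith-comm; zipWith-assoc; zipWith-identityˡ; zipWith-identityʳ; ∷-injective; tabulate∘lookup;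
         tabulate-cong; ≡-dec)
open import Data.List using (List; []; _∷_; map; _++_; length; filter)
open import Data.List.Properties using (length-map)
open import Data.List.Relation.Unary.All as All using (All; []; _∷_)
import Data.List.Relation.Unary.All.Properties as Allₚ
import Data.List.Relation.Unary.AllPairs as AllPairs
import Data.List.Relation.Unary.AllPairs.Properties as AllPairsₚ
open import Data.List.Relation.Unary.Any as Any using (Any; here; there)
open import Data.List.Membership.Propositional using (_∈_)
open import Data.List.Membership.Propositional.Properties using (∈-map⁺; ∈-map⁻; ∈-++⁺ˡ; ∈-++⁺ʳ; ∈-filter⁺)
open import Data.List.Relation.Unary.Unique.Propositional using (Unique; []; _∷_)
import Data.List.Relation.Unary.Unique.Propositional.Properties as Uniqueₚ
open import Data.Product using (Σ; _,_; _×_; proj₁; proj₂; uncurry)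
open import Data.Empty using (⊥-elim)
open import Function using (_∘_)
open import Relation.Nullary using (¬_; Dec; does; yes; no)
open import Relation.Nullary.Decidable using (T?; dec-true; dec-false; from-no)
open import Relation.Unary using (Decidable)
open import Relation.Binary.Definitions using (DecidableEquality)
open import Relation.Binary.PropositionalEquality
open import Algebra.Properties.CommutativeSemigroup +-commutativeSemigroup
  using () renaming (interchange to +-interchange)
open import Algebra.Properties.CommutativeSemigroup (CommutativeRing.+-commutativeSemigroup xor-∧-commutativeRing)
  using () renaming (interchange to xor-interchange)

⟦_⟧ : Bool → ℕ
⟦ true ⟧ = 1
⟦ false ⟧ = 0

⟦⟧≤1 : ∀ b → ⟦ b ⟧ ≤ 1
⟦⟧≤1 true = s≤s z≤n
⟦⟧≤1 false = z≤n

⟦⟧-idem : ∀ b → ⟦ b ⟧ * ⟦ b ⟧ ≡ ⟦ b ⟧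
⟦⟧-idem true = refl
⟦⟧-idem false = refl

⟦∧⟧ : ∀ p q → ⟦ p ∧ q ⟧ ≡ ⟦ p ⟧ * ⟦ q ⟧
⟦∧⟧ true q = sym (+-identityʳ ⟦ q ⟧)
⟦∧⟧ false q = refl

∑ : {A : Set} → List A → (A → ℕ) → ℕ
∑ [] f = 0
∑ (x ∷ xs) f = f x + ∑ xs f

syntax ∑ xs (λ x → e) = ∑[ x ∈ xs ] e

module _ {A : Set} where

  ∑-cong : (xs : List A) {f g : A → ℕ} → (∀ x → f x ≡ g x) → ∑ xs f ≡ ∑ xs g
  ∑-cong [] eq = refl
  ∑-cong (x ∷ xs) eq = cong₂ _+_ (eq x) (∑-cong xs eq)

  ∑-congᴬ : {xs : List A} {f g : A → ℕ} → All (λ x → f x ≡ g x) xs → ∑ xs f ≡ ∑ xs g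
  ∑-congᴬ [] = refl
  ∑-congᴬ (eq ∷ eqs) = cong₂ _+_ eq (∑-congᴬ eqs)

  ∑-distrib-+ : (xs : List A) (f g : A → ℕ) → ∑[ x ∈ xs ] (f x + g x) ≡ ∑ xs f + ∑ xs g
  ∑-distrib-+ [] f g = refl
  ∑-distrib-+ (x ∷ xs) f g = trans (cong (f x + g x +_) (∑-distrib-+ xs f g)) (+-interchange (f x) (g x) _ _)

  ∑-*ˡ : (xs : List A) (c : ℕ) (f : A → ℕ) → ∑[ x ∈ xs ] (c * f x) ≡ c * ∑ xs f
  ∑-*ˡ [] c f = sym (*-zeroʳ c)
  ∑-*ˡ (x ∷ xs) c f = trans (cong (c * f x +_) (∑-*ˡ xs c f)) (sym (*-distribˡ-+ c (f x) _))

  ∑-*ʳ : (xs : List A) (f : A → ℕ) (c : ℕ) → ∑[ x ∈ xs ] (f x * c) ≡ ∑ xs f * c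
  ∑-*ʳ xs f c = trans (∑-cong xs (λ x → *-comm (f x) c)) (trans (∑-*ˡ xs c f) (*-comm c _))

  ∑-const : (xs : List A) (c : ℕ) → ∑[ x ∈ xs ] c ≡ length xs * c
  ∑-const [] c = refl
  ∑-const (x ∷ xs) c = cong (c +_) (∑-const xs c)

  ∑-++ : (xs ys : List A) (f : A → ℕ) → ∑ (xs ++ ys) f ≡ ∑ xs f + ∑ ys f
  ∑-++ [] ys f = refl
  ∑-++ (x ∷ xs) ys f = trans (cong (f x +_) (∑-++ xs ys f)) (sym (+-assoc (f x) _ _))

  ∑-map : {B : Set} (g : B → A) (ys : List B) (f : A → ℕ) → ∑ (map g ys) f ≡ ∑[ y ∈ ys ] f (g y)
  ∑-map g [] f = refl
  ∑-map g (y ∷ ys) f = cong (f (g y) +_) (∑-map g ys f)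

  ∑-mono-≤ : (xs : List A) {f g : A → ℕ} → (∀ x → f x ≤ g x) → ∑ xs f ≤ ∑ xs g
  ∑-mono-≤ [] le = z≤n
  ∑-mono-≤ (x ∷ xs) le = +-mono-≤ (le x) (∑-mono-≤ xs le)

  length-filter-∑ : {P : A → Set} (P? : Decidable P) (xs : List A) →
                    length (filter P? xs) ≡ ∑[ x ∈ xs ] ⟦ does (P? x) ⟧
  length-filter-∑ P? [] = refl
  length-filter-∑ P? (x ∷ xs) with does (P? x)
  ... | true = cong suc (length-filter-∑ P? xs)
  ... | false = length-filter-∑ P? xs

  ∑-saturated : (xs : List A) (f : A → ℕ) → (∀ x → f x ≤ 1) → ∑ xs f ≡ length xs →
                All (λ x → f x ≡ 1) xs
  ∑-saturated [] f le eq = []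
  ∑-saturated (x ∷ xs) f le eq with f x in fx | le x
  ... | 1 | _ = fx ∷ ∑-saturated xs f le (suc-injective eq)
  ... | suc (suc _) | s≤s ()
  ... | 0 | _ = ⊥-elim (<⇒≱ (≤-reflexive (sym eq)) ∑≤length)
    where
      ∑≤length : ∑ xs f ≤ length xs
      ∑≤length = ≤-trans (∑-mono-≤ xs le) (≤-reflexive (trans (∑-const xs 1) (*-identityʳ _)))

  ∑-⟦⟧-zero : (p : A → Bool) {xs : List A} → All (λ x → p x ≡ false) xs → ∑[ x ∈ xs ] ⟦ p x ⟧ ≡ 0
  ∑-⟦⟧-zero p [] = refl
  ∑-⟦⟧-zero p (px ∷ pxs) rewrite px = ∑-⟦⟧-zero p pxs

  ∑-⟦⟧-≤1 : (p : A → Bool) {xs : List A} → Unique xs →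
            (∀ {x y} → p x ≡ true → p y ≡ true → x ≡ y) → ∑[ x ∈ xs ] ⟦ p x ⟧ ≤ 1
  ∑-⟦⟧-≤1 p [] p-unique = z≤n
  ∑-⟦⟧-≤1 p {x ∷ xs} (x∉xs ∷ xs!) p-unique with p x in px
  ... | false = ∑-⟦⟧-≤1 p xs! p-unique
  ... | true = ≤-reflexive (cong suc (∑-⟦⟧-zero p (All.map (λ x≢y → ¬-not (x≢y ∘ p-unique px)) x∉xs)))

  ∑-δ-absent : (_≟_ : DecidableEquality A) {x : A} {xs : List A} (g : A → ℕ) → All (x ≢_) xs →
               ∑[ y ∈ xs ] (⟦ does (x ≟ y) ⟧ * g y) ≡ 0
  ∑-δ-absent _≟_ g [] = refl
  ∑-δ-absent _≟_ {x} g (x≢y ∷ x∉ys) rewrite dec-false (x ≟ _) x≢y = ∑-δ-absent _≟_ g x∉ys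

  ∑-δ : (_≟_ : DecidableEquality A) {x : A} {xs : List A} (g : A → ℕ) → Unique xs → x ∈ xs →
        ∑[ y ∈ xs ] (⟦ does (x ≟ y) ⟧ * g y) ≡ g x
  ∑-δ _≟_ {x} g (x∉xs ∷ _) (here refl) rewrite dec-true (x ≟ x) refl | ∑-δ-absent _≟_ g x∉xs =
    trans (+-identityʳ _) (+-identityʳ (g x))
  ∑-δ _≟_ {x} {y ∷ ys} g (y∉ys ∷ ys!) (there x∈ys)
    rewrite dec-false (x ≟ y) (λ { refl → All.lookup y∉ys x∈ys refl }) = ∑-δ _≟_ g ys! x∈ys

∑-comm : {A B : Set} (xs : List A) (ys : List B) (f : A → B → ℕ) →
         ∑[ x ∈ xs ] ∑ ys (f x) ≡ ∑[ y ∈ ys ] ∑[ x ∈ xs ] f x y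
∑-comm [] ys f = sym (trans (∑-const ys 0) (*-zeroʳ (length ys)))
∑-comm (x ∷ xs) ys f =
  trans (cong (∑ ys (f x) +_) (∑-comm xs ys f)) (sym (∑-distrib-+ ys (f x) _))

∑-fibres : {A B : Set} (_≟_ : DecidableEquality B) {vs : List B} → Unique vs →
           (xs : List A) (f : A → B) → All (λ x → f x ∈ vs) xs → (g : B → ℕ) →
           ∑[ x ∈ xs ] g (f x) ≡ ∑[ v ∈ vs ] (∑[ x ∈ xs ] ⟦ does (f x ≟ v) ⟧ * g v)
∑-fibres _≟_ {vs} vs! xs f f∈vs g = begin
  ∑[ x ∈ xs ] g (f x)                             ≡⟨ ∑-congᴬ (All.map (sym ∘ ∑-δ _≟_ g vs!) f∈vs) ⟩
  ∑[ x ∈ xs ] ∑[ v ∈ vs ] (⟦ does (f x ≟ v) ⟧ * g v) ≡⟨ ∑-comm xs vs _ ⟩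
  ∑[ v ∈ vs ] ∑[ x ∈ xs ] (⟦ does (f x ≟ v) ⟧ * g v) ≡⟨ ∑-cong vs (λ v → ∑-*ʳ xs _ (g v)) ⟩
  ∑[ v ∈ vs ] (∑[ x ∈ xs ] ⟦ does (f x ≟ v) ⟧ * g v) ∎
  where open ≡-Reasoning

∑-*-∑ : {A B : Set} (xs : List A) (ys : List B) (f : A → ℕ) (g : B → ℕ) →
        ∑ xs f * ∑ ys g ≡ ∑[ x ∈ xs ] ∑[ y ∈ ys ] (f x * g y)
∑-*-∑ xs ys f g = trans (sym (∑-*ʳ xs f (∑ ys g))) (∑-cong xs (λ x → sym (∑-*ˡ ys (f x) g)))

∑-square : {A B : Set} (as : List A) (xs : List B) (f : A → B → ℕ) (w : B → ℕ) →
           ∑[ a ∈ as ] (∑[ x ∈ xs ] (f a x * w x) * ∑[ x ∈ xs ] (f a x * w x))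
           ≡ ∑[ x ∈ xs ] ∑[ y ∈ xs ] (w x * w y * ∑[ a ∈ as ] (f a x * f a y))
∑-square as xs f w = begin
  ∑[ a ∈ as ] (∑[ x ∈ xs ] (f a x * w x) * ∑[ x ∈ xs ] (f a x * w x))
    ≡⟨ ∑-cong as (λ a → ∑-*-∑ xs xs (λ x → f a x * w x) (λ y → f a y * w y)) ⟩
  ∑[ a ∈ as ] ∑[ x ∈ xs ] ∑[ y ∈ xs ] (f a x * w x * (f a y * w y))
    ≡⟨ ∑-comm as xs _ ⟩
  ∑[ x ∈ xs ] ∑[ a ∈ as ] ∑[ y ∈ xs ] (f a x * w x * (f a y * w y))
    ≡⟨ ∑-cong xs (λ x → ∑-comm as xs _) ⟩
  ∑[ x ∈ xs ] ∑[ y ∈ xs ] ∑[ a ∈ as ] (f a x * w x * (f a y * w y))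
    ≡⟨ ∑-cong xs (λ x → ∑-cong xs (λ y → trans (∑-cong as (λ a → regroup (f a x) (w x) (f a y) (w y)))
                                                (∑-*ˡ as (w x * w y) (λ a → f a x * f a y)))) ⟩
  ∑[ x ∈ xs ] ∑[ y ∈ xs ] (w x * w y * ∑[ a ∈ as ] (f a x * f a y)) ∎
  where
    open ≡-Reasoning
    regroup : ∀ p q r s → p * q * (r * s) ≡ q * s * (p * r)
    regroup = solve-∀

module _ {n : ℕ} where

  infixl 6 _⊕ᵥ_
  _⊕ᵥ_ : 𝔽₂^ n → 𝔽₂^ n → 𝔽₂^ n
  _⊕ᵥ_ = zipWith _xor_

  zeros : 𝔽₂^ n
  zeros = replicate n false

  ⊕-comm : ∀ x y → x ⊕ᵥ y ≡ y ⊕ᵥ x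
  ⊕-comm = zipWith-comm xor-comm

  ⊕-assoc : ∀ x y z → (x ⊕ᵥ y) ⊕ᵥ z ≡ x ⊕ᵥ (y ⊕ᵥ z)
  ⊕-assoc = zipWith-assoc xor-assoc

  ⊕-identityˡ : ∀ x → zeros ⊕ᵥ x ≡ x
  ⊕-identityˡ = zipWith-identityˡ xor-identityˡ

  ⊕-identityʳ : ∀ x → x ⊕ᵥ zeros ≡ x
  ⊕-identityʳ = zipWith-identityʳ xor-identityʳ

⊕-self : ∀ {n} (x : 𝔽₂^ n) → x ⊕ᵥ x ≡ zeros
⊕-self [] = refl
⊕-self (b ∷ x) = cong₂ _∷_ (xor-same b) (⊕-self x)

⊕-cancelˡ : ∀ {n} (x y : 𝔽₂^ n) → x ⊕ᵥ (x ⊕ᵥ y) ≡ y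
⊕-cancelˡ x y = begin
  x ⊕ᵥ (x ⊕ᵥ y) ≡⟨ sym (⊕-assoc x x y) ⟩
  (x ⊕ᵥ x) ⊕ᵥ y ≡⟨ cong (_⊕ᵥ y) (⊕-self x) ⟩
  zeros ⊕ᵥ y    ≡⟨ ⊕-identityˡ y ⟩
  y             ∎
  where open ≡-Reasoning

⊕≡zeros⇒≡ : ∀ {n} {x y : 𝔽₂^ n} → x ⊕ᵥ y ≡ zeros → x ≡ y
⊕≡zeros⇒≡ {x = x} {y} eq = trans (sym (⊕-identityʳ x)) (trans (cong (x ⊕ᵥ_) (sym eq)) (⊕-cancelˡ x y))

infix 7 _·_
_·_ : ∀ {n} → 𝔽₂^ n → 𝔽₂^ n → Bool
[] · [] = false
(a ∷ as) · (x ∷ xs) = (a ∧ x) xor (as · xs)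

·-comm : ∀ {n} (a x : 𝔽₂^ n) → a · x ≡ x · a
·-comm [] [] = refl
·-comm (a ∷ as) (x ∷ xs) = cong₂ _xor_ (∧-comm a x) (·-comm as xs)

·-zeroʳ : ∀ {n} (a : 𝔽₂^ n) → a · zeros ≡ false
·-zeroʳ [] = refl
·-zeroʳ (a ∷ as) = trans (cong (_xor (as · zeros)) (∧-zeroʳ a)) (·-zeroʳ as)

·-distribˡ-⊕ : ∀ {n} (a x y : 𝔽₂^ n) → a · (x ⊕ᵥ y) ≡ (a · x) xor (a · y)
·-distribˡ-⊕ [] [] [] = refl
·-distribˡ-⊕ (a ∷ as) (x ∷ xs) (y ∷ ys) = begin
  (a ∧ (x xor y)) xor (as · (xs ⊕ᵥ ys))
    ≡⟨ cong₂ _xor_ (∧-distribˡ-xor a x y) (·-distribˡ-⊕ as xs ys) ⟩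
  ((a ∧ x) xor (a ∧ y)) xor ((as · xs) xor (as · ys))
    ≡⟨ xor-interchange (a ∧ x) (a ∧ y) (as · xs) (as · ys) ⟩
  ((a ∧ x) xor (as · xs)) xor ((a ∧ y) xor (as · ys)) ∎
  where open ≡-Reasoning

unit : ∀ {n} → Fin n → 𝔽₂^ n
unit Fin.zero = true ∷ zeros
unit (Fin.suc k) = false ∷ unit k

·-unit : ∀ {n} (a : 𝔽₂^ n) (k : Fin n) → a · unit k ≡ lookup a k
·-unit (a ∷ as) Fin.zero = trans (cong₂ _xor_ (∧-identityʳ a) (·-zeroʳ as)) (xor-identityʳ a)
·-unit (a ∷ as) (Fin.suc k) = trans (cong (_xor (as · unit k)) (∧-zeroʳ a)) (·-unit as k)

≢zeros⇒lookup≡true : ∀ {n} {a : 𝔽₂^ n} → a ≢ zeros → Σ (Fin n) λ k → lookup a k ≡ true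
≢zeros⇒lookup≡true {a = []} a≢0 = ⊥-elim (a≢0 refl)
≢zeros⇒lookup≡true {a = true ∷ a} a≢0 = Fin.zero , refl
≢zeros⇒lookup≡true {a = false ∷ a} a≢0 with ≢zeros⇒lookup≡true (a≢0 ∘ cong (false ∷_))
... | k , ak = Fin.suc k , ak

Additive : ∀ {n} → (𝔽₂^ n → Bool) → Set
Additive φ = ∀ x y → φ (x ⊕ᵥ y) ≡ φ x xor φ y

additive-zero : ∀ {n} (φ : 𝔽₂^ n → Bool) → Additive φ → φ zeros ≡ false
additive-zero φ φ-additive = begin
  φ zeros              ≡⟨ cong φ (sym (⊕-self zeros)) ⟩
  φ (zeros ⊕ᵥ zeros)   ≡⟨ φ-additive zeros zeros ⟩
  φ zeros xor φ zeros  ≡⟨ xor-same (φ zeros) ⟩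
  false                ∎
  where open ≡-Reasoning

coefficients : ∀ {n} → (𝔽₂^ n → Bool) → 𝔽₂^ n
coefficients φ = tabulate (φ ∘ unit)

additive⇒·coefficients : ∀ {n} (φ : 𝔽₂^ n → Bool) → Additive φ → ∀ x → φ x ≡ coefficients φ · x
additive⇒·coefficients {zero} φ φ-additive [] = additive-zero φ φ-additive
additive⇒·coefficients {suc n} φ φ-additive (b ∷ x) = begin
  φ (b ∷ x)
    ≡⟨ cong φ (cong₂ _∷_ (sym (xor-identityʳ b)) (sym (⊕-identityˡ x))) ⟩
  φ ((b ∷ zeros) ⊕ᵥ (false ∷ x))
    ≡⟨ φ-additive (b ∷ zeros) (false ∷ x) ⟩
  φ (b ∷ zeros) xor φ (false ∷ x)
    ≡⟨ cong₂ _xor_ (head b) (additive⇒·coefficients (φ ∘ (false ∷_)) tail-additive x) ⟩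
  (φ (unit Fin.zero) ∧ b) xor (coefficients (φ ∘ (false ∷_)) · x) ∎
  where
    open ≡-Reasoning
    tail-additive : Additive (φ ∘ (false ∷_))
    tail-additive y z = φ-additive (false ∷ y) (false ∷ z)
    head : ∀ b → φ (b ∷ zeros) ≡ φ (unit Fin.zero) ∧ b
    head true = sym (∧-identityʳ _)
    head false = trans (additive-zero φ φ-additive) (sym (∧-zeroʳ _))

∈-allVecs : ∀ {n} (x : 𝔽₂^ n) → x ∈ allVecs n
∈-allVecs [] = here refl
∈-allVecs {suc n} (false ∷ x) = ∈-++⁺ˡ (∈-map⁺ (false ∷_) (∈-allVecs x))
∈-allVecs {suc n} (true ∷ x) = ∈-++⁺ʳ (map (false ∷_) (allVecs n)) (∈-map⁺ (true ∷_) (∈-allVecs x))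

allVecs-unique : ∀ n → Unique (allVecs n)
allVecs-unique zero = [] ∷ []
allVecs-unique (suc n) =
  Uniqueₚ.++⁺ (Uniqueₚ.map⁺ (proj₂ ∘ ∷-injective) (allVecs-unique n))
             (Uniqueₚ.map⁺ (proj₂ ∘ ∷-injective) (allVecs-unique n))
             different-heads
  where
    different-heads : ∀ {v} → ¬ (v ∈ map (false ∷_) (allVecs n) × v ∈ map (true ∷_) (allVecs n))
    different-heads (v∈ˡ , v∈ʳ) with ∈-map⁻ (false ∷_) v∈ˡ | ∈-map⁻ (true ∷_) v∈ʳ
    ... | _ , _ , refl | _ , _ , ()

nonzeroVecs : ∀ n → List (𝔽₂^ n)
nonzeroVecs zero = []
nonzeroVecs (suc n) = map (false ∷_) (nonzeroVecs n) ++ map (true ∷_) (allVecs n)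

allVecs≡zeros∷nonzeroVecs : ∀ n → allVecs n ≡ zeros ∷ nonzeroVecs n
allVecs≡zeros∷nonzeroVecs zero = refl
allVecs≡zeros∷nonzeroVecs (suc n) rewrite allVecs≡zeros∷nonzeroVecs n = refl

∑-allVecs : ∀ n (f : 𝔽₂^ n → ℕ) → ∑ (allVecs n) f ≡ f zeros + ∑ (nonzeroVecs n) f
∑-allVecs n f = cong (λ xs → ∑ xs f) (allVecs≡zeros∷nonzeroVecs n)

∈-nonzeroVecs : ∀ {n} {x : 𝔽₂^ n} → x ≢ zeros → x ∈ nonzeroVecs n
∈-nonzeroVecs {n} {x} x≢0 with subst (x ∈_) (allVecs≡zeros∷nonzeroVecs n) (∈-allVecs x)
... | here x≡0 = ⊥-elim (x≢0 x≡0)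
... | there x∈nz = x∈nz

nonzeroVecs-unique : ∀ n → Unique (nonzeroVecs n)
nonzeroVecs-unique n with subst Unique (allVecs≡zeros∷nonzeroVecs n) (allVecs-unique n)
... | _ ∷ nz! = nz!

nonzeroVecs-nonzero : ∀ n → All (_≢ zeros) (nonzeroVecs n)
nonzeroVecs-nonzero n with subst Unique (allVecs≡zeros∷nonzeroVecs n) (allVecs-unique n)
... | 0∉nz ∷ _ = All.map (_∘ sym) 0∉nz

∑-allVecs-suc : ∀ n (f : 𝔽₂^ (suc n) → ℕ) →
                ∑ (allVecs (suc n)) f ≡ ∑[ x ∈ allVecs n ] f (false ∷ x) + ∑[ x ∈ allVecs n ] f (true ∷ x)
∑-allVecs-suc n f = trans (∑-++ (map (false ∷_) (allVecs n)) _ f)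
                          (cong₂ _+_ (∑-map (false ∷_) (allVecs n) f) (∑-map (true ∷_) (allVecs n) f))

∑-translate : ∀ n (v : 𝔽₂^ n) (f : 𝔽₂^ n → ℕ) → ∑ (allVecs n) f ≡ ∑[ x ∈ allVecs n ] f (v ⊕ᵥ x)
∑-translate zero [] f = refl
∑-translate (suc n) (b ∷ v) f = begin
  ∑ (allVecs (suc n)) f                           ≡⟨ ∑-allVecs-suc n f ⟩
  ∑[ x ∈ allVecs n ] f (false ∷ x) + ∑[ x ∈ allVecs n ] f (true ∷ x)
    ≡⟨ cong₂ _+_ (∑-translate n v (f ∘ (false ∷_))) (∑-translate n v (f ∘ (true ∷_))) ⟩
  shifted false + shifted true                    ≡⟨ swap b ⟩
  shifted (b xor false) + shifted (b xor true)    ≡⟨ sym (∑-allVecs-suc n (λ x → f ((b ∷ v) ⊕ᵥ x))) ⟩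
  ∑[ x ∈ allVecs (suc n) ] f ((b ∷ v) ⊕ᵥ x)       ∎
  where
    open ≡-Reasoning
    shifted : Bool → ℕ
    shifted c = ∑[ x ∈ allVecs n ] f (c ∷ v ⊕ᵥ x)
    swap : ∀ b → shifted false + shifted true ≡ shifted (b xor false) + shifted (b xor true)
    swap false = refl
    swap true = +-comm (shifted false) (shifted true)

ker : V → SubsetV
ker a x = not (a · x)

_∩_ : SubsetV → SubsetV → SubsetV
(S ∩ T) x = S x ∧ T x

-- Opaque so that the type checker never unfolds a sum over the 128 concrete vectors.
opaque
  vectors : List V
  vectors = allVecs 7

  nonzeroVectors : List V
  nonzeroVectors = nonzeroVecs 7

opaque
  unfolding vectors nonzeroVectors

  card-∑ : (S : SubsetV) → card S ≡ ∑[ x ∈ vectors ] ⟦ S x ⟧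
  card-∑ S = length-filter-∑ (T? ∘ S) (allVecs 7)

  length-vectors : length vectors ≡ 128
  length-vectors = refl

  ∑-nonzero-const : (c : ℕ) → ∑[ x ∈ nonzeroVectors ] c ≡ 127 * c
  ∑-nonzero-const = ∑-const (nonzeroVecs 7)

  ∑-vectors : (f : V → ℕ) → ∑ vectors f ≡ f 𝟎 + ∑ nonzeroVectors f
  ∑-vectors = ∑-allVecs 7

  ∑-vectors-translate : (v : V) (f : V → ℕ) → ∑ vectors f ≡ ∑[ x ∈ vectors ] f (v ⊕ x)
  ∑-vectors-translate = ∑-translate 7

  ∈-vectors : (x : V) → x ∈ vectors
  ∈-vectors = ∈-allVecs

  ∈-nonzeroVectors : {x : V} → x ≢ 𝟎 → x ∈ nonzeroVectors
  ∈-nonzeroVectors = ∈-nonzeroVecs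

  nonzeroVectors-unique : Unique nonzeroVectors
  nonzeroVectors-unique = nonzeroVecs-unique 7

  nonzeroVectors-nonzero : All (_≢ 𝟎) nonzeroVectors
  nonzeroVectors-nonzero = nonzeroVecs-nonzero 7

card-cong : {S T : SubsetV} → S ≗ T → card S ≡ card T
card-cong {S} {T} S≗T = trans (card-∑ S) (trans (∑-cong vectors (cong ⟦_⟧ ∘ S≗T)) (sym (card-∑ T)))

m+m≡n+n⇒m≡n : ∀ {m} n → m + m ≡ n + n → m ≡ n
m+m≡n+n⇒m≡n {m} n eq = trans (n≡⌊n+n/2⌋ m) (trans (cong ⌊_/2⌋ eq) (sym (n≡⌊n+n/2⌋ n)))

ker⇒·≡false : ∀ a x → ker a x ≡ true → a · x ≡ false
ker⇒·≡false a x = not-injective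

ker-isSubspace : (a : V) → IsSubspace (ker a)
ker-isSubspace a = cong not (·-zeroʳ a) , closed
  where
    closed : ∀ x y → ker a x ≡ true → ker a y ≡ true → ker a (x ⊕ y) ≡ true
    closed x y x∈ y∈ = trans (cong not (·-distribˡ-⊕ a x y))
                             (cong₂ (λ u v → not (u xor v)) (ker⇒·≡false a x x∈) (ker⇒·≡false a y y∈))

ker-injective : {a b : V} → ker a ≗ ker b → a ≡ b
ker-injective {a} {b} eq = begin
  a                          ≡⟨ sym (tabulate∘lookup a) ⟩
  tabulate (lookup a)        ≡⟨ tabulate-cong same-coordinates ⟩
  tabulate (lookup b)        ≡⟨ tabulate∘lookup b ⟩
  b                          ∎
  where
    open ≡-Reasoning
    same-coordinates : lookup a ≗ lookup b
    same-coordinates k = trans (sym (·-unit a k)) (trans (not-injective (eq (unit k))) (·-unit b k))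

ker-translate : ∀ a {y} → a · y ≡ true → ∀ x → ker a (y ⊕ x) ≡ not (ker a x)
ker-translate a {y} a·y x rewrite ·-distribˡ-⊕ a y x | a·y = refl

module _ {P : SubsetV} (P-subspace : IsSubspace P) where

  private
    closed : ∀ x y → P x ≡ true → P y ≡ true → P (x ⊕ y) ≡ true
    closed = proj₂ P-subspace

  subspace-translate : ∀ {y} → P y ≡ true → ∀ x → P (y ⊕ x) ≡ P x
  subspace-translate {y} y∈ x with P x in x∈
  ... | true = closed y x y∈ x∈
  ... | false with P (y ⊕ x) in y⊕x∈
  ...   | false = refl
  ...   | true = sym (trans (sym x∈) (trans (cong P (sym (⊕-cancelˡ y x))) (closed y (y ⊕ x) y∈ y⊕x∈)))

  card-∩-ker-half : ∀ a {y} → P y ≡ true → a · y ≡ true → card (P ∩ ker a) + card (P ∩ ker a) ≡ card P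
  card-∩-ker-half a {y} y∈ a·y = begin
    card (P ∩ ker a) + card (P ∩ ker a)
      ≡⟨ cong₂ _+_ (card-∑ (P ∩ ker a))
                   (trans (card-∑ (P ∩ ker a)) (∑-vectors-translate y (λ x → ⟦ P x ∧ ker a x ⟧))) ⟩
    ∑[ x ∈ vectors ] ⟦ P x ∧ ker a x ⟧ + ∑[ x ∈ vectors ] ⟦ P (y ⊕ x) ∧ ker a (y ⊕ x) ⟧
      ≡⟨ cong (∑[ x ∈ vectors ] ⟦ P x ∧ ker a x ⟧ +_) (∑-cong vectors λ x →
           cong₂ (λ p h → ⟦ p ∧ h ⟧) (subspace-translate y∈ x) (ker-translate a a·y x)) ⟩
    ∑[ x ∈ vectors ] ⟦ P x ∧ ker a x ⟧ + ∑[ x ∈ vectors ] ⟦ P x ∧ not (ker a x) ⟧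
      ≡⟨ sym (∑-distrib-+ vectors (λ x → ⟦ P x ∧ ker a x ⟧) (λ x → ⟦ P x ∧ not (ker a x) ⟧)) ⟩
    ∑[ x ∈ vectors ] (⟦ P x ∧ ker a x ⟧ + ⟦ P x ∧ not (ker a x) ⟧)
      ≡⟨ ∑-cong vectors (λ x → ⟦∧⟧+⟦∧not⟧ (P x) (ker a x)) ⟩
    ∑[ x ∈ vectors ] ⟦ P x ⟧
      ≡⟨ sym (card-∑ P) ⟩
    card P ∎
    where
      open ≡-Reasoning
      ⟦∧⟧+⟦∧not⟧ : ∀ p h → ⟦ p ∧ h ⟧ + ⟦ p ∧ not h ⟧ ≡ ⟦ p ⟧
      ⟦∧⟧+⟦∧not⟧ true true = refl
      ⟦∧⟧+⟦∧not⟧ true false = refl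
      ⟦∧⟧+⟦∧not⟧ false h = refl

allᵇ⇒All : {A : Set} (p : A → Bool) (xs : List A) → allᵇ p xs ≡ true → All (λ x → p x ≡ true) xs
allᵇ⇒All p [] _ = []
allᵇ⇒All p (x ∷ xs) all-p with p x in px
... | true = px ∷ allᵇ⇒All p xs all-p

allᵇ⇒Any : {A : Set} (p : A → Bool) (xs : List A) → allᵇ p xs ≡ false → Any (λ x → p x ≡ false) xs
allᵇ⇒Any p (x ∷ xs) not-all with p x in px
... | true = there (allᵇ⇒Any p xs not-all)
... | false = here px

⊆ᵇ⇒⊆ : (P Q : SubsetV) → (P ⊆ᵇ Q) ≡ true → ∀ x → not (P x) ∨ Q x ≡ true
⊆ᵇ⇒⊆ P Q P⊆Q x = All.lookup (allᵇ⇒All (λ x → not (P x) ∨ Q x) (allVecs 7) P⊆Q) (∈-allVecs x)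

allᵇ-cong : {A : Set} {p q : A → Bool} (xs : List A) → (∀ x → p x ≡ q x) → allᵇ p xs ≡ allᵇ q xs
allᵇ-cong [] _ = refl
allᵇ-cong (x ∷ xs) p≗q = cong₂ _∧_ (p≗q x) (allᵇ-cong xs p≗q)

⊆ᵇ-congʳ : (P : SubsetV) {S T : SubsetV} → S ≗ T → (P ⊆ᵇ S) ≡ (P ⊆ᵇ T)
⊆ᵇ-congʳ P S≗T = allᵇ-cong (allVecs 7) (λ x → cong (not (P x) ∨_) (S≗T x))

card-∩-⊆ : (P Q : SubsetV) → (P ⊆ᵇ Q) ≡ true → card (P ∩ Q) ≡ card P
card-∩-⊆ P Q P⊆Q = begin
  card (P ∩ Q)                      ≡⟨ card-∑ (P ∩ Q) ⟩
  ∑[ x ∈ vectors ] ⟦ P x ∧ Q x ⟧  ≡⟨ ∑-cong vectors (λ x → pointwise (P x) (Q x) (⊆ᵇ⇒⊆ P Q P⊆Q x)) ⟩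
  ∑[ x ∈ vectors ] ⟦ P x ⟧        ≡⟨ sym (card-∑ P) ⟩
  card P                            ∎
  where
    open ≡-Reasoning
    pointwise : ∀ p q → not p ∨ q ≡ true → ⟦ p ∧ q ⟧ ≡ ⟦ p ⟧
    pointwise true true _ = refl
    pointwise false q _ = refl

⊈ᵇ⇒witness : (P Q : SubsetV) → (P ⊆ᵇ Q) ≡ false → Σ V λ y → P y ≡ true × Q y ≡ false
⊈ᵇ⇒witness P Q P⊈Q = witness (allᵇ⇒Any (λ x → not (P x) ∨ Q x) (allVecs 7) P⊈Q)
  where
    witness : {xs : List V} → Any (λ x → not (P x) ∨ Q x ≡ false) xs → Σ V λ y → P y ≡ true × Q y ≡ false
    witness {y ∷ _} (here py) with P y in y∈P | Q y in y∈Q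
    ... | true | false = y , y∈P , y∈Q
    witness (there any) = witness any

card-plane-∩-ker : {P : SubsetV} → IsPlane P → ∀ a → card (P ∩ ker a) ≡ 4 + 4 * ⟦ P ⊆ᵇ ker a ⟧
card-plane-∩-ker {P} (P-subspace , card-P) a with P ⊆ᵇ ker a in P⊆?
... | true = trans (card-∩-⊆ P (ker a) P⊆?) card-P
... | false with ⊈ᵇ⇒witness P (ker a) P⊆?
...   | y , y∈P , y∉ker =
  m+m≡n+n⇒m≡n 4 (trans (card-∩-ker-half {P} P-subspace a y∈P (not-injective {y = true} y∉ker)) card-P)

card-ker : {a : V} → a ≢ 𝟎 → card (ker a) ≡ 64
card-ker {a} a≢0 with ≢zeros⇒lookup≡true a≢0
... | k , a[k] = m+m≡n+n⇒m≡n 64 (trans (card-∩-ker-half whole-space a {unit k} refl (trans (·-unit a k) a[k])) refl)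
  where
    whole-space : IsSubspace (λ _ → true)
    whole-space = refl , λ _ _ _ _ → refl

ker-isHyperplane : {a : V} → a ≢ 𝟎 → IsHyperplane (ker a)
ker-isHyperplane {a} a≢0 = ker-isSubspace a , card-ker a≢0

module _ {S : SubsetV} (S-hyperplane : IsHyperplane S) where

  private
    S-subspace : IsSubspace S
    S-subspace = proj₁ S-hyperplane
    card-S : card S ≡ 64
    card-S = proj₂ S-hyperplane

  -- S and v ⊕ S are disjoint sets of 64 vectors, so together they exhaust 𝔽₂⁷.
  hyperplane-∉⊕∉⇒∈ : ∀ {v z} → S v ≡ false → S z ≡ false → S (v ⊕ z) ≡ true
  hyperplane-∉⊕∉⇒∈ {v} {z} v∉S z∉S =
    from-one (S z) (S (v ⊕ z)) z∉S (All.lookup (∑-saturated vectors f f≤1 ∑f≡128) (∈-vectors z))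
    where
      f : V → ℕ
      f x = ⟦ S x ⟧ + ⟦ S (v ⊕ x) ⟧
      f≤1 : ∀ x → f x ≤ 1
      f≤1 x with S x in x∈S
      ... | false = ⟦⟧≤1 (S (v ⊕ x))
      ... | true = ≤-reflexive (cong (λ b → 1 + ⟦ b ⟧) (trans (cong S (⊕-comm v x))
                                                          (trans (subspace-translate S-subspace x∈S v) v∉S)))
      ∑f≡128 : ∑ vectors f ≡ length vectors
      ∑f≡128 = begin
        ∑ vectors f
          ≡⟨ ∑-distrib-+ vectors (λ x → ⟦ S x ⟧) (λ x → ⟦ S (v ⊕ x) ⟧) ⟩
        ∑[ x ∈ vectors ] ⟦ S x ⟧ + ∑[ x ∈ vectors ] ⟦ S (v ⊕ x) ⟧
          ≡⟨ cong (∑[ x ∈ vectors ] ⟦ S x ⟧ +_) (sym (∑-vectors-translate v (λ x → ⟦ S x ⟧))) ⟩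
        ∑[ x ∈ vectors ] ⟦ S x ⟧ + ∑[ x ∈ vectors ] ⟦ S x ⟧
          ≡⟨ cong₂ _+_ S-size S-size ⟩
        64 + 64
          ≡⟨ sym length-vectors ⟩
        length vectors ∎
        where
          open ≡-Reasoning
          S-size : ∑[ x ∈ vectors ] ⟦ S x ⟧ ≡ 64
          S-size = trans (sym (card-∑ S)) card-S
      from-one : ∀ s t → s ≡ false → ⟦ s ⟧ + ⟦ t ⟧ ≡ 1 → t ≡ true
      from-one false true _ _ = refl

  hyperplane-complement-additive : Additive (not ∘ S)
  hyperplane-complement-additive x y with S x in x∈S | S y in y∈S
  ... | true | _ = cong not (trans (subspace-translate S-subspace x∈S y) y∈S)
  ... | false | true = cong not (trans (cong S (⊕-comm x y)) (trans (subspace-translate S-subspace y∈S x) x∈S))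
  ... | false | false = cong not (hyperplane-∉⊕∉⇒∈ x∈S y∈S)

  hyperplane≗ker : S ≗ ker (coefficients (not ∘ S))
  hyperplane≗ker x = trans (sym (not-involutive (S x)))
                           (cong not (additive⇒·coefficients (not ∘ S) hyperplane-complement-additive x))

  hyperplane-coefficients≢𝟎 : coefficients (not ∘ S) ≢ 𝟎
  hyperplane-coefficients≢𝟎 a≡0 = 64≢128 (trans (sym card-S) (card-cong (subst (λ a → S ≗ ker a) a≡0 hyperplane≗ker)))
    where
      64≢128 : 64 ≢ 128
      64≢128 ()

hyperplane⇒ker : {S : SubsetV} → IsHyperplane S → Σ V λ a → a ≢ 𝟎 × S ≗ ker a
hyperplane⇒ker S-hyperplane =
  _ , hyperplane-coefficients≢𝟎 S-hyperplane , hyperplane≗ker S-hyperplane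

_≟ᵥ_ : DecidableEquality V
_≟ᵥ_ = ≡-dec _≟ᵇ_

∑-nonzero-ker : {a : V} → a ≢ 𝟎 → ∑[ x ∈ nonzeroVectors ] ⟦ ker a x ⟧ ≡ 63
∑-nonzero-ker {a} a≢0 = +-cancelˡ-≡ 1 _ 63 (begin
  1 + ∑[ x ∈ nonzeroVectors ] ⟦ ker a x ⟧
    ≡⟨ cong (λ b → ⟦ not b ⟧ + ∑[ x ∈ nonzeroVectors ] ⟦ ker a x ⟧) (sym (·-zeroʳ a)) ⟩
  ⟦ ker a 𝟎 ⟧ + ∑[ x ∈ nonzeroVectors ] ⟦ ker a x ⟧ ≡⟨ sym (∑-vectors (λ x → ⟦ ker a x ⟧)) ⟩
  ∑[ x ∈ vectors ] ⟦ ker a x ⟧               ≡⟨ sym (card-∑ (ker a)) ⟩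
  card (ker a)                               ≡⟨ card-ker a≢0 ⟩
  64                                         ∎)
  where open ≡-Reasoning

hyperplanes-through : {x : V} → x ≢ 𝟎 → ∑[ a ∈ nonzeroVectors ] ⟦ ker a x ⟧ ≡ 63
hyperplanes-through {x} x≢0 = trans (∑-cong nonzeroVectors (λ a → cong (⟦_⟧ ∘ not) (·-comm a x))) (∑-nonzero-ker x≢0)

-- Since a · (x ⊕ y) = a · x xor a · y, the kernel of a contains all of x, y, x ⊕ y or exactly one.
ker-∋-x-y-x⊕y : ∀ a x y →
  ⟦ ker a x ⟧ + ⟦ ker a y ⟧ + ⟦ ker a (x ⊕ y) ⟧ ≡ 1 + 2 * (⟦ ker a x ⟧ * ⟦ ker a y ⟧)
ker-∋-x-y-x⊕y a x y rewrite ·-distribˡ-⊕ a x y with a · x | a · y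
... | true | true = refl
... | true | false = refl
... | false | true = refl
... | false | false = refl

hyperplanes-through-pair : {x y : V} → x ≢ 𝟎 → y ≢ 𝟎 →
  ∑[ a ∈ nonzeroVectors ] (⟦ ker a x ⟧ * ⟦ ker a y ⟧) ≡ 31 + 32 * ⟦ does (x ≟ᵥ y) ⟧
hyperplanes-through-pair {x} {y} x≢0 y≢0 with x ≟ᵥ y
... | yes refl = trans (∑-cong nonzeroVectors (λ a → ⟦⟧-idem (ker a x))) (hyperplanes-through x≢0)
... | no x≢y = *-cancelˡ-≡ pairs 31 2 (+-cancelˡ-≡ 127 _ _ (begin
  127 + 2 * pairs
    ≡⟨ cong₂ _+_ (sym (∑-nonzero-const 1)) (sym (∑-*ˡ nonzeroVectors 2 χxy)) ⟩
  ∑[ a ∈ nonzeroVectors ] 1 + ∑[ a ∈ nonzeroVectors ] (2 * χxy a)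
    ≡⟨ sym (∑-distrib-+ nonzeroVectors (λ _ → 1) (λ a → 2 * χxy a)) ⟩
  ∑[ a ∈ nonzeroVectors ] (1 + 2 * χxy a)
    ≡⟨ ∑-cong nonzeroVectors (λ a → sym (ker-∋-x-y-x⊕y a x y)) ⟩
  ∑[ a ∈ nonzeroVectors ] (χ x a + χ y a + χ (x ⊕ y) a)
    ≡⟨ ∑-distrib-+ nonzeroVectors (λ a → χ x a + χ y a) (χ (x ⊕ y)) ⟩
  ∑[ a ∈ nonzeroVectors ] (χ x a + χ y a) + ∑ nonzeroVectors (χ (x ⊕ y))
    ≡⟨ cong (_+ ∑ nonzeroVectors (χ (x ⊕ y))) (∑-distrib-+ nonzeroVectors (χ x) (χ y)) ⟩
  ∑ nonzeroVectors (χ x) + ∑ nonzeroVectors (χ y) + ∑ nonzeroVectors (χ (x ⊕ y))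
    ≡⟨ cong₂ _+_ (cong₂ _+_ (hyperplanes-through x≢0) (hyperplanes-through y≢0))
                 (hyperplanes-through (x≢y ∘ ⊕≡zeros⇒≡)) ⟩
  127 + 2 * 31 ∎))
  where
    open ≡-Reasoning
    χ : V → V → ℕ
    χ z a = ⟦ ker a z ⟧
    χxy : V → ℕ
    χxy a = χ x a * χ y a
    pairs : ℕ
    pairs = ∑ nonzeroVectors χxy

nonzeroCard : SubsetV → ℕ
nonzeroCard X = ∑[ x ∈ nonzeroVectors ] ⟦ X x ⟧

incidences : SubsetV → V → ℕ
incidences X a = ∑[ x ∈ nonzeroVectors ] (⟦ ker a x ⟧ * ⟦ X x ⟧)

module _ (X : SubsetV) where

  private
    N : ℕ
    N = nonzeroCard X

  ∑-incidences : ∑[ a ∈ nonzeroVectors ] incidences X a ≡ 63 * N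
  ∑-incidences = begin
    ∑[ a ∈ nonzeroVectors ] incidences X a
      ≡⟨ ∑-comm nonzeroVectors nonzeroVectors (λ a x → ⟦ ker a x ⟧ * ⟦ X x ⟧) ⟩
    ∑[ x ∈ nonzeroVectors ] ∑[ a ∈ nonzeroVectors ] (⟦ ker a x ⟧ * ⟦ X x ⟧)
      ≡⟨ ∑-congᴬ (All.map (λ {x} x≢0 → trans (∑-*ʳ nonzeroVectors (λ a → ⟦ ker a x ⟧) ⟦ X x ⟧)
                                              (cong (_* ⟦ X x ⟧) (hyperplanes-through x≢0)))
                          nonzeroVectors-nonzero) ⟩
    ∑[ x ∈ nonzeroVectors ] (63 * ⟦ X x ⟧)
      ≡⟨ ∑-*ˡ nonzeroVectors 63 (λ x → ⟦ X x ⟧) ⟩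
    63 * N ∎
    where open ≡-Reasoning

  ∑-incidences² : ∑[ a ∈ nonzeroVectors ] (incidences X a * incidences X a) ≡ 31 * (N * N) + 32 * N
  ∑-incidences² = begin
    ∑[ a ∈ nonzeroVectors ] (incidences X a * incidences X a)
      ≡⟨ ∑-square nonzeroVectors nonzeroVectors (λ a x → ⟦ ker a x ⟧) (λ x → ⟦ X x ⟧) ⟩
    ∑[ x ∈ nonzeroVectors ] ∑[ y ∈ nonzeroVectors ]
      (⟦ X x ⟧ * ⟦ X y ⟧ * ∑[ a ∈ nonzeroVectors ] (⟦ ker a x ⟧ * ⟦ ker a y ⟧))
      ≡⟨ ∑-congᴬ (All.map (λ {x} x≢0 → ∑-congᴬ (All.map (λ {y} y≢0 →
           cong (⟦ X x ⟧ * ⟦ X y ⟧ *_) (hyperplanes-through-pair x≢0 y≢0)) nonzeroVectors-nonzero))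
                          nonzeroVectors-nonzero) ⟩
    ∑[ x ∈ nonzeroVectors ] ∑[ y ∈ nonzeroVectors ] (⟦ X x ⟧ * ⟦ X y ⟧ * (31 + 32 * ⟦ does (x ≟ᵥ y) ⟧))
      ≡⟨ ∑-congᴬ (All.map (row _) nonzeroVectors-nonzero) ⟩
    ∑[ x ∈ nonzeroVectors ] (31 * N * ⟦ X x ⟧ + 32 * ⟦ X x ⟧)
      ≡⟨ ∑-distrib-+ nonzeroVectors (λ x → 31 * N * ⟦ X x ⟧) (λ x → 32 * ⟦ X x ⟧) ⟩
    ∑[ x ∈ nonzeroVectors ] (31 * N * ⟦ X x ⟧) + ∑[ x ∈ nonzeroVectors ] (32 * ⟦ X x ⟧)
      ≡⟨ cong₂ _+_ (trans (∑-*ˡ nonzeroVectors (31 * N) (λ x → ⟦ X x ⟧)) (*-assoc 31 N N))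
                   (∑-*ˡ nonzeroVectors 32 (λ x → ⟦ X x ⟧)) ⟩
    31 * (N * N) + 32 * N ∎
    where
      open ≡-Reasoning
      expand : ∀ p q d → p * q * (31 + 32 * d) ≡ p * (31 * q + 32 * (d * q))
      expand = solve-∀
      collect : ∀ m p → p * (m + 32 * p) ≡ m * p + 32 * (p * p)
      collect = solve-∀
      row : ∀ x → x ≢ 𝟎 → ∑[ y ∈ nonzeroVectors ] (⟦ X x ⟧ * ⟦ X y ⟧ * (31 + 32 * ⟦ does (x ≟ᵥ y) ⟧))
                          ≡ 31 * N * ⟦ X x ⟧ + 32 * ⟦ X x ⟧
      row x x≢0 = begin
        ∑[ y ∈ nonzeroVectors ] (⟦ X x ⟧ * ⟦ X y ⟧ * (31 + 32 * ⟦ does (x ≟ᵥ y) ⟧))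
          ≡⟨ ∑-cong nonzeroVectors (λ y → expand ⟦ X x ⟧ ⟦ X y ⟧ ⟦ does (x ≟ᵥ y) ⟧) ⟩
        ∑[ y ∈ nonzeroVectors ] (⟦ X x ⟧ * (31 * ⟦ X y ⟧ + 32 * (⟦ does (x ≟ᵥ y) ⟧ * ⟦ X y ⟧)))
          ≡⟨ ∑-*ˡ nonzeroVectors ⟦ X x ⟧ _ ⟩
        ⟦ X x ⟧ * ∑[ y ∈ nonzeroVectors ] (31 * ⟦ X y ⟧ + 32 * (⟦ does (x ≟ᵥ y) ⟧ * ⟦ X y ⟧))
          ≡⟨ cong (⟦ X x ⟧ *_) (trans (∑-distrib-+ nonzeroVectors _ _)
                                      (cong₂ _+_ (∑-*ˡ nonzeroVectors 31 _) (∑-*ˡ nonzeroVectors 32 _))) ⟩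
        ⟦ X x ⟧ * (31 * N + 32 * ∑[ y ∈ nonzeroVectors ] (⟦ does (x ≟ᵥ y) ⟧ * ⟦ X y ⟧))
          ≡⟨ cong (λ s → ⟦ X x ⟧ * (31 * N + 32 * s))
                  (∑-δ _≟ᵥ_ (λ y → ⟦ X y ⟧) nonzeroVectors-unique (∈-nonzeroVectors x≢0)) ⟩
        ⟦ X x ⟧ * (31 * N + 32 * ⟦ X x ⟧)
          ≡⟨ collect (31 * N) ⟦ X x ⟧ ⟩
        31 * N * ⟦ X x ⟧ + 32 * (⟦ X x ⟧ * ⟦ X x ⟧)
          ≡⟨ cong (λ s → 31 * N * ⟦ X x ⟧ + 32 * s) (⟦⟧-idem (X x)) ⟩
        31 * N * ⟦ X x ⟧ + 32 * ⟦ X x ⟧ ∎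

incidences≤nonzeroCard : (X : SubsetV) (a : V) → incidences X a ≤ nonzeroCard X
incidences≤nonzeroCard X a = ∑-mono-≤ nonzeroVectors (λ x → ⟦⟧*-≤ (ker a x) ⟦ X x ⟧)
  where
    ⟦⟧*-≤ : ∀ b n → ⟦ b ⟧ * n ≤ n
    ⟦⟧*-≤ true n = ≤-reflexive (+-identityʳ n)
    ⟦⟧*-≤ false n = z≤n

length-allFins : ∀ m → length (allFins m) ≡ m
length-allFins zero = refl
length-allFins (suc m) = cong suc (trans (length-map Fin.suc (allFins m)) (length-allFins m))

allFins-unique : ∀ m → Unique (allFins m)
allFins-unique zero = []
allFins-unique (suc m) = Allₚ.map⁺ (All.universal (λ _ ()) (allFins m))
                       ∷ Uniqueₚ.map⁺ Finₚ.suc-injective (allFins-unique m)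

blocksIn-∑ : ∀ {m} (B : Fin m → SubsetV) (S : SubsetV) → blocksIn m B S ≡ ∑[ j ∈ allFins m ] ⟦ B j ⊆ᵇ S ⟧
blocksIn-∑ {m} B S = length-filter-∑ (T? ∘ (λ j → B j ⊆ᵇ S)) (allFins m)

blocksIn-cong : ∀ {m} (B : Fin m → SubsetV) {S T : SubsetV} → S ≗ T → blocksIn m B S ≡ blocksIn m B T
blocksIn-cong {m} B {S} {T} S≗T =
  trans (blocksIn-∑ B S) (trans (∑-cong (allFins m) (λ j → cong ⟦_⟧ (⊆ᵇ-congʳ (B j) S≗T))) (sym (blocksIn-∑ B T)))

module _ {m : ℕ} (B : Fin m → SubsetV) (spread : IsPartialPlaneSpread m B) where

  private
    B-plane : ∀ j → IsPlane (B j)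
    B-plane = proj₁ spread
    B-disjoint : ∀ i j → i ≢ j → ∀ x → B i x ≡ true → B j x ≡ true → x ≡ 𝟎
    B-disjoint = proj₂ spread

  cover : V → ℕ
  cover x = ∑[ j ∈ allFins m ] ⟦ B j x ⟧

  uncovered : SubsetV
  uncovered x = does (cover x ≟ 0)

  cover-𝟎 : cover 𝟎 ≡ m
  cover-𝟎 = begin
    cover 𝟎                 ≡⟨ ∑-cong (allFins m) (λ j → cong ⟦_⟧ (proj₁ (proj₁ (B-plane j)))) ⟩
    ∑[ j ∈ allFins m ] 1    ≡⟨ ∑-const (allFins m) 1 ⟩
    length (allFins m) * 1  ≡⟨ trans (*-identityʳ _) (length-allFins m) ⟩
    m                       ∎
    where open ≡-Reasoning

  cover-≤1 : ∀ {x} → x ≢ 𝟎 → cover x ≤ 1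
  cover-≤1 {x} x≢0 = ∑-⟦⟧-≤1 (λ j → B j x) (allFins-unique m) same-block
    where
      same-block : ∀ {i j} → B i x ≡ true → B j x ≡ true → i ≡ j
      same-block {i} {j} x∈Bi x∈Bj with i Finₚ.≟ j
      ... | yes i≡j = i≡j
      ... | no i≢j = ⊥-elim (x≢0 (B-disjoint i j i≢j x x∈Bi x∈Bj))

  cover+uncovered : ∀ {x} → x ≢ 𝟎 → cover x + ⟦ uncovered x ⟧ ≡ 1
  cover+uncovered {x} x≢0 with cover x | cover-≤1 x≢0
  ... | 0 | _ = refl
  ... | 1 | _ = refl
  ... | suc (suc _) | s≤s ()

  ∑-cover : ∑[ x ∈ vectors ] cover x ≡ m * 8
  ∑-cover = begin
    ∑[ x ∈ vectors ] cover x
      ≡⟨ ∑-comm vectors (allFins m) (λ x j → ⟦ B j x ⟧) ⟩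
    ∑[ j ∈ allFins m ] ∑[ x ∈ vectors ] ⟦ B j x ⟧
      ≡⟨ ∑-cong (allFins m) (λ j → trans (sym (card-∑ (B j))) (proj₂ (B-plane j))) ⟩
    ∑[ j ∈ allFins m ] 8
      ≡⟨ trans (∑-const (allFins m) 8) (cong (_* 8) (length-allFins m)) ⟩
    m * 8 ∎
    where open ≡-Reasoning

  uncovered-count : m * 7 + nonzeroCard uncovered ≡ 127
  uncovered-count = begin
    m * 7 + nonzeroCard uncovered
      ≡⟨ cong (_+ nonzeroCard uncovered) nonzero-cover ⟩
    ∑[ x ∈ nonzeroVectors ] cover x + nonzeroCard uncovered
      ≡⟨ sym (∑-distrib-+ nonzeroVectors cover (λ x → ⟦ uncovered x ⟧)) ⟩
    ∑[ x ∈ nonzeroVectors ] (cover x + ⟦ uncovered x ⟧)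
      ≡⟨ ∑-congᴬ (All.map cover+uncovered nonzeroVectors-nonzero) ⟩
    ∑[ x ∈ nonzeroVectors ] 1
      ≡⟨ ∑-nonzero-const 1 ⟩
    127 ∎
    where
      open ≡-Reasoning
      nonzero-cover : m * 7 ≡ ∑[ x ∈ nonzeroVectors ] cover x
      nonzero-cover = +-cancelˡ-≡ m _ _ (begin
        m + m * 7                                  ≡⟨ sym (*-suc m 7) ⟩
        m * 8                                      ≡⟨ sym ∑-cover ⟩
        ∑[ x ∈ vectors ] cover x                   ≡⟨ ∑-vectors cover ⟩
        cover 𝟎 + ∑[ x ∈ nonzeroVectors ] cover x  ≡⟨ cong (_+ ∑[ x ∈ nonzeroVectors ] cover x) cover-𝟎 ⟩
        m + ∑[ x ∈ nonzeroVectors ] cover x        ∎)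

  ∑-card-∩-ker≡cover : ∀ a →
    ∑[ j ∈ allFins m ] card (B j ∩ ker a) ≡ m + ∑[ x ∈ nonzeroVectors ] (⟦ ker a x ⟧ * cover x)
  ∑-card-∩-ker≡cover a = begin
    ∑[ j ∈ allFins m ] card (B j ∩ ker a)
      ≡⟨ ∑-cong (allFins m) (λ j → card-∑ (B j ∩ ker a)) ⟩
    ∑[ j ∈ allFins m ] ∑[ x ∈ vectors ] ⟦ B j x ∧ ker a x ⟧
      ≡⟨ ∑-comm (allFins m) vectors (λ j x → ⟦ B j x ∧ ker a x ⟧) ⟩
    ∑[ x ∈ vectors ] ∑[ j ∈ allFins m ] ⟦ B j x ∧ ker a x ⟧
      ≡⟨ ∑-cong vectors column ⟩
    ∑[ x ∈ vectors ] (⟦ ker a x ⟧ * cover x)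
      ≡⟨ ∑-vectors (λ x → ⟦ ker a x ⟧ * cover x) ⟩
    ⟦ ker a 𝟎 ⟧ * cover 𝟎 + ∑[ x ∈ nonzeroVectors ] (⟦ ker a x ⟧ * cover x)
      ≡⟨ cong₂ (λ b c → ⟦ not b ⟧ * c + ∑[ x ∈ nonzeroVectors ] (⟦ ker a x ⟧ * cover x)) (·-zeroʳ a) cover-𝟎 ⟩
    1 * m + ∑[ x ∈ nonzeroVectors ] (⟦ ker a x ⟧ * cover x)
      ≡⟨ cong (_+ ∑[ x ∈ nonzeroVectors ] (⟦ ker a x ⟧ * cover x)) (+-identityʳ m) ⟩
    m + ∑[ x ∈ nonzeroVectors ] (⟦ ker a x ⟧ * cover x) ∎
    where
      open ≡-Reasoning
      column : ∀ x → ∑[ j ∈ allFins m ] ⟦ B j x ∧ ker a x ⟧ ≡ ⟦ ker a x ⟧ * cover x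
      column x = trans (∑-cong (allFins m) (λ j → trans (⟦∧⟧ (B j x) (ker a x)) (*-comm ⟦ B j x ⟧ ⟦ ker a x ⟧)))
                       (∑-*ˡ (allFins m) ⟦ ker a x ⟧ (λ j → ⟦ B j x ⟧))

  ∑-card-∩-ker≡blocksIn : ∀ a → ∑[ j ∈ allFins m ] card (B j ∩ ker a) ≡ 4 * m + 4 * blocksIn m B (ker a)
  ∑-card-∩-ker≡blocksIn a = begin
    ∑[ j ∈ allFins m ] card (B j ∩ ker a)
      ≡⟨ ∑-cong (allFins m) (λ j → card-plane-∩-ker (B-plane j) a) ⟩
    ∑[ j ∈ allFins m ] (4 + 4 * ⟦ B j ⊆ᵇ ker a ⟧)
      ≡⟨ ∑-distrib-+ (allFins m) (λ _ → 4) (λ j → 4 * ⟦ B j ⊆ᵇ ker a ⟧) ⟩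
    ∑[ j ∈ allFins m ] 4 + ∑[ j ∈ allFins m ] (4 * ⟦ B j ⊆ᵇ ker a ⟧)
      ≡⟨ cong₂ _+_ (trans (∑-const (allFins m) 4) (trans (cong (_* 4) (length-allFins m)) (*-comm m 4)))
                   (trans (∑-*ˡ (allFins m) 4 (λ j → ⟦ B j ⊆ᵇ ker a ⟧)) (cong (4 *_) (sym (blocksIn-∑ B (ker a))))) ⟩
    4 * m + 4 * blocksIn m B (ker a) ∎
    where open ≡-Reasoning

  covered+uncovered-in-ker : ∀ {a} → a ≢ 𝟎 →
    ∑[ x ∈ nonzeroVectors ] (⟦ ker a x ⟧ * cover x) + incidences uncovered a ≡ 63
  covered+uncovered-in-ker {a} a≢0 = begin
    ∑[ x ∈ nonzeroVectors ] (⟦ ker a x ⟧ * cover x) + incidences uncovered a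
      ≡⟨ sym (∑-distrib-+ nonzeroVectors (λ x → ⟦ ker a x ⟧ * cover x) (λ x → ⟦ ker a x ⟧ * ⟦ uncovered x ⟧)) ⟩
    ∑[ x ∈ nonzeroVectors ] (⟦ ker a x ⟧ * cover x + ⟦ ker a x ⟧ * ⟦ uncovered x ⟧)
      ≡⟨ ∑-congᴬ (All.map point nonzeroVectors-nonzero) ⟩
    ∑[ x ∈ nonzeroVectors ] ⟦ ker a x ⟧
      ≡⟨ ∑-nonzero-ker a≢0 ⟩
    63 ∎
    where
      open ≡-Reasoning
      point : ∀ {x} → x ≢ 𝟎 → ⟦ ker a x ⟧ * cover x + ⟦ ker a x ⟧ * ⟦ uncovered x ⟧ ≡ ⟦ ker a x ⟧
      point {x} x≢0 = trans (sym (*-distribˡ-+ ⟦ ker a x ⟧ (cover x) ⟦ uncovered x ⟧))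
                            (trans (cong (⟦ ker a x ⟧ *_) (cover+uncovered x≢0)) (*-identityʳ ⟦ ker a x ⟧))

  ker-point-count : ∀ {a} → a ≢ 𝟎 → 3 * m + 4 * blocksIn m B (ker a) + incidences uncovered a ≡ 63
  ker-point-count {a} a≢0 = +-cancelˡ-≡ m _ _ (begin
    m + (3 * m + 4 * i + h)    ≡⟨ regroup m i h ⟩
    (4 * m + 4 * i) + h        ≡⟨ cong (_+ h) (trans (sym (∑-card-∩-ker≡blocksIn a)) (∑-card-∩-ker≡cover a)) ⟩
    (m + c) + h                ≡⟨ +-assoc m c h ⟩
    m + (c + h)                ≡⟨ cong (m +_) (covered+uncovered-in-ker a≢0) ⟩
    m + 63                     ∎)
    where
      open ≡-Reasoning
      i h c : ℕ
      i = blocksIn m B (ker a)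
      h = incidences uncovered a
      c = ∑[ x ∈ nonzeroVectors ] (⟦ ker a x ⟧ * cover x)
      regroup : ∀ m i h → m + (3 * m + 4 * i + h) ≡ 4 * m + 4 * i + h
      regroup = solve-∀

hyperplanes-HasCount : (Q : SubsetV → Set) (Q? : ∀ S → Dec (Q S)) → (∀ {S T} → S ≗ T → Q S → Q T) →
                       HasCount (λ S → IsHyperplane S × Q S) (length (filter (Q? ∘ ker) nonzeroVectors))
hyperplanes-HasCount Q Q? Q-resp =
  map ker selected , length-map ker selected , all-hyperplanes , distinct , complete
  where
    selected : List V
    selected = filter (Q? ∘ ker) nonzeroVectors

    all-hyperplanes : All (λ S → IsHyperplane S × Q S) (map ker selected)
    all-hyperplanes = Allₚ.map⁺ (All.map (uncurry λ a≢0 Q-ker-a → ker-isHyperplane a≢0 , Q-ker-a)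
      (All.zip (Allₚ.filter⁺ (Q? ∘ ker) nonzeroVectors-nonzero , Allₚ.all-filter (Q? ∘ ker) nonzeroVectors)))

    distinct : AllPairs.AllPairs (λ S T → ¬ S ≗ T) (map ker selected)
    distinct = AllPairsₚ.map⁺ (AllPairs.map (_∘ ker-injective) (AllPairsₚ.filter⁺ (Q? ∘ ker) nonzeroVectors-unique))

    complete : ∀ S → IsHyperplane S × Q S → Any.Any (S ≗_) (map ker selected)
    complete S (S-hyperplane , Q-S) with hyperplane⇒ker S-hyperplane
    ... | a , a≢0 , S≗ker-a =
      Any.map (λ ker-a≡T x → trans (S≗ker-a x) (cong-app ker-a≡T x))
              (∈-map⁺ ker (∈-filter⁺ (Q? ∘ ker) (∈-nonzeroVectors a≢0) (Q-resp S≗ker-a Q-S)))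

fibreSize : {A : Set} → List A → (A → ℕ) → ℕ → ℕ
fibreSize xs f v = ∑[ x ∈ xs ] ⟦ does (f x ≟ v) ⟧

∑-fibres-123 : {A : Set} (xs : List A) (f : A → ℕ) → All (λ x → f x ∈ 1 ∷ 2 ∷ 3 ∷ []) xs → (g : ℕ → ℕ) →
               ∑[ x ∈ xs ] g (f x) ≡ g 1 * fibreSize xs f 1 + g 2 * fibreSize xs f 2 + g 3 * fibreSize xs f 3
∑-fibres-123 xs f f∈123 g = trans (∑-fibres _≟_ 123-unique xs f f∈123 g)
  (reorder (fibreSize xs f 1) (fibreSize xs f 2) (fibreSize xs f 3) (g 1) (g 2) (g 3))
  where
    123-unique : Unique (1 ∷ 2 ∷ 3 ∷ [])
    123-unique = ((λ ()) ∷ (λ ()) ∷ []) ∷ ((λ ()) ∷ []) ∷ [] ∷ []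
    reorder : ∀ n₁ n₂ n₃ g₁ g₂ g₃ → n₁ * g₁ + (n₂ * g₂ + (n₃ * g₃ + 0)) ≡ g₁ * n₁ + g₂ * n₂ + g₃ * n₃
    reorder = solve-∀

spectrum-equations-solution : ∀ k₁ k₂ k₃ →
                 1 * k₁ + 1 * k₂ + 1 * k₃ ≡ 127 →
                 8 * k₁ + 4 * k₂ + 0 * k₃ ≡ 504 →
                 64 * k₁ + 16 * k₂ + 0 * k₃ ≡ 2240 →
                 k₁ ≡ 7 × k₂ ≡ 112 × k₃ ≡ 8
spectrum-equations-solution k₁ k₂ k₃ e₀ e₁ e₂ = k₁≡7 , k₂≡112 , k₃≡8
  where
    first : 2 * k₁ + k₂ ≡ 126
    first = *-cancelˡ-≡ _ 126 4 (trans (regroup₁ k₁ k₂) e₁)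
      where regroup₁ : ∀ k₁ k₂ → 4 * (2 * k₁ + k₂) ≡ 8 * k₁ + 4 * k₂ + 0
            regroup₁ = solve-∀
    second : 4 * k₁ + k₂ ≡ 140
    second = *-cancelˡ-≡ _ 140 16 (trans (regroup₂ k₁ k₂) e₂)
      where regroup₂ : ∀ k₁ k₂ → 16 * (4 * k₁ + k₂) ≡ 64 * k₁ + 16 * k₂ + 0
            regroup₂ = solve-∀
    k₁≡7 : k₁ ≡ 7
    k₁≡7 = *-cancelˡ-≡ k₁ 7 2 (+-cancelʳ-≡ 126 (2 * k₁) 14 (begin
      2 * k₁ + 126              ≡⟨ cong (2 * k₁ +_) (sym first) ⟩
      2 * k₁ + (2 * k₁ + k₂)    ≡⟨ regroup₃ k₁ k₂ ⟩
      4 * k₁ + k₂               ≡⟨ second ⟩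
      14 + 126                  ∎))
      where
        open ≡-Reasoning
        regroup₃ : ∀ k₁ k₂ → 2 * k₁ + (2 * k₁ + k₂) ≡ 4 * k₁ + k₂
        regroup₃ = solve-∀
    k₂≡112 : k₂ ≡ 112
    k₂≡112 = +-cancelˡ-≡ 14 k₂ 112 (trans (cong (λ k → 2 * k + k₂) (sym k₁≡7)) first)
    k₃≡8 : k₃ ≡ 8
    k₃≡8 = +-cancelˡ-≡ 119 k₃ 8 (trans (cong₂ (λ k k′ → 1 * k + 1 * k′ + k₃) (sym k₁≡7) (sym k₂≡112))
                                       (trans (cong (1 * k₁ + 1 * k₂ +_) (sym (+-identityʳ k₃))) e₀))

module _ (B : Fin 17 → SubsetV) (spread : IsPartialPlaneSpread 17 B) where

  private
    X : SubsetV
    X = uncovered B spread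
    blocks holes : V → ℕ
    blocks a = blocksIn 17 B (ker a)
    holes = incidences X
    spec : ℕ → ℕ
    spec = fibreSize nonzeroVectors blocks

  nonzeroCard-uncovered : nonzeroCard X ≡ 8
  nonzeroCard-uncovered = +-cancelˡ-≡ 119 _ 8 (uncovered-count B spread)

  hyperplane-types : ∀ {a} → a ≢ 𝟎 → blocks a ∈ 1 ∷ 2 ∷ 3 ∷ [] × holes a ≡ 12 ∸ 4 * blocks a
  hyperplane-types {a} a≢0 = types (blocks a) (holes a)
    (trans (cong (λ t → 3 * 17 + t + holes a) {blocks a * 4} (*-comm (blocks a) 4)) (ker-point-count B spread {a} a≢0))
    (≤-trans (incidences≤nonzeroCard X a) (≤-reflexive nonzeroCard-uncovered))
    where
      types : ∀ i h → 3 * 17 + i * 4 + h ≡ 63 → h ≤ 8 → i ∈ 1 ∷ 2 ∷ 3 ∷ [] × h ≡ 12 ∸ 4 * i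
      types 0 .12 refl 12≤8 = ⊥-elim (from-no (12 ≤? 8) 12≤8)
      types 1 .8 refl _ = here refl , refl
      types 2 .4 refl _ = there (here refl) , refl
      types 3 .0 refl _ = there (there (here refl)) , refl
      types (suc (suc (suc (suc i)))) h () _

  private
    blocks-types : All (λ a → blocks a ∈ 1 ∷ 2 ∷ 3 ∷ []) nonzeroVectors
    blocks-types = All.map (λ {a} a≢0 → proj₁ (hyperplane-types {a} a≢0)) nonzeroVectors-nonzero
    holes-types : All (λ a → holes a ≡ 12 ∸ 4 * blocks a) nonzeroVectors
    holes-types = All.map (λ {a} a≢0 → proj₂ (hyperplane-types {a} a≢0)) nonzeroVectors-nonzero

  spec-123 : spec 1 ≡ 7 × spec 2 ≡ 112 × spec 3 ≡ 8
  spec-123 = spectrum-equations-solution (spec 1) (spec 2) (spec 3) hyperplanes holes-sum holes-square-sum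
    where
      open ≡-Reasoning
      hyperplanes : 1 * spec 1 + 1 * spec 2 + 1 * spec 3 ≡ 127
      hyperplanes = trans (sym (∑-fibres-123 nonzeroVectors blocks blocks-types (λ _ → 1))) (∑-nonzero-const 1)
      holes-sum : 8 * spec 1 + 4 * spec 2 + 0 * spec 3 ≡ 504
      holes-sum = begin
        8 * spec 1 + 4 * spec 2 + 0 * spec 3
          ≡⟨ sym (∑-fibres-123 nonzeroVectors blocks blocks-types (λ i → 12 ∸ 4 * i)) ⟩
        ∑[ a ∈ nonzeroVectors ] (12 ∸ 4 * blocks a)  ≡⟨ sym (∑-congᴬ holes-types) ⟩
        ∑[ a ∈ nonzeroVectors ] holes a              ≡⟨ ∑-incidences X ⟩
        63 * nonzeroCard X                           ≡⟨ cong (63 *_) nonzeroCard-uncovered ⟩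
        504                                          ∎
      holes-square-sum : 64 * spec 1 + 16 * spec 2 + 0 * spec 3 ≡ 2240
      holes-square-sum = begin
        64 * spec 1 + 16 * spec 2 + 0 * spec 3
          ≡⟨ sym (∑-fibres-123 nonzeroVectors blocks blocks-types (λ i → (12 ∸ 4 * i) * (12 ∸ 4 * i))) ⟩
        ∑[ a ∈ nonzeroVectors ] ((12 ∸ 4 * blocks a) * (12 ∸ 4 * blocks a))
          ≡⟨ sym (∑-congᴬ (All.map (λ e → cong₂ _*_ e e) holes-types)) ⟩
        ∑[ a ∈ nonzeroVectors ] (holes a * holes a)
          ≡⟨ ∑-incidences² X ⟩
        31 * (nonzeroCard X * nonzeroCard X) + 32 * nonzeroCard X
          ≡⟨ cong (λ N → 31 * (N * N) + 32 * N) nonzeroCard-uncovered ⟩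
        2240 ∎

  spectrum : ∀ i → spec i ≡ expectedSpectrum i
  spectrum i = begin
    spec i
      ≡⟨ ∑-fibres-123 nonzeroVectors blocks blocks-types (λ v → ⟦ does (v ≟ i) ⟧) ⟩
    ⟦ does (1 ≟ i) ⟧ * spec 1 + ⟦ does (2 ≟ i) ⟧ * spec 2 + ⟦ does (3 ≟ i) ⟧ * spec 3
      ≡⟨ cong₂ _+_ (cong₂ _+_ (cong (⟦ does (1 ≟ i) ⟧ *_) spec-1) (cong (⟦ does (2 ≟ i) ⟧ *_) spec-2))
                   (cong (⟦ does (3 ≟ i) ⟧ *_) spec-3) ⟩
    ⟦ does (1 ≟ i) ⟧ * 7 + ⟦ does (2 ≟ i) ⟧ * 112 + ⟦ does (3 ≟ i) ⟧ * 8
      ≡⟨ read-off i ⟩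
    expectedSpectrum i ∎
    where
      open ≡-Reasoning
      spec-1 : spec 1 ≡ 7
      spec-1 = proj₁ spec-123
      spec-2 : spec 2 ≡ 112
      spec-2 = proj₁ (proj₂ spec-123)
      spec-3 : spec 3 ≡ 8
      spec-3 = proj₂ (proj₂ spec-123)
      read-off : ∀ i → ⟦ does (1 ≟ i) ⟧ * 7 + ⟦ does (2 ≟ i) ⟧ * 112 + ⟦ does (3 ≟ i) ⟧ * 8 ≡ expectedSpectrum i
      read-off 0 = refl
      read-off 1 = refl
      read-off 2 = refl
      read-off 3 = refl
      read-off (suc (suc (suc (suc _)))) = refl

lemma3p2 : (B : Fin 17 → SubsetV) → IsPartialPlaneSpread 17 B →
           (i : ℕ) → HasSpectrumValue 17 B i (expectedSpectrum i)
lemma3p2 B spread i =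
  subst (HasSpectrumValue 17 B i)
        (trans (length-filter-∑ (λ a → blocksIn 17 B (ker a) ≟ i) nonzeroVectors) (spectrum B spread i))
        (hyperplanes-HasCount (λ S → blocksIn 17 B S ≡ i) (λ S → blocksIn 17 B S ≟ i)
                              (λ S≗T → trans (sym (blocksIn-cong B S≗T))))
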